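{- Consider a Bounded Knapsack Problem instance with items $I=\{1,\dots,n\}$ (profits $p_i$, weights $w_i$, availabilities $d_i$, all positive integers), capacity $W$, items indexed in non-increasing order of efficiency $e_i=p_i/w_i$, break item $b$, left items $I_{\text{left}}=\{i:i<b\}$, incumbent value $z$, unfixed availability vector $u$, and $I^1_{\text{left}}=\{i\in I_{\text{left}}:u_i=1\}$ (as in the context). Fix $h\in I^1_{\text{left}}$ and consider the modified instance in which the demand of $h$ is decreased by one, with fixed amounts $f_i$ and residual availabilities $r_i$ as in the context. Let $(\widehat p_h,\widehat w_h)=(\sum_if_ip_i,\sum_if_iw_i)$ be the total profit and weight of the item copies fixed inside the knapsack, let $I_{\text{res}}=\{i:r_i>0\}$ (assumed nonempty), let $\overline W_h=\widehat w_h+\lfloor (W-\widehat w_h)/\gamma\rfloor\gamma$ where $\gamma$ is the gcd of $\{w_i:i\in I_{\text{res}}\}$, and let $g$ be an item of $I_{\text{res}}$ of highest efficiency. Then $$\mathrm{UB}_h=\widehat p_h+\bigl(\overline W_h-\widehat w_h\bigr)e_g$$ is a valid upper bound for the modified BKP: every integer vector $x$ with $f_i\le x_i\le f_i+r_i$ for all $i$ and $\sum_iw_ix_i\le W$ satisfies $\sum_ip_ix_i\le \mathrm{UB}_h$.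
   Context: The break item $b$ satisfies $\sum_{i<b}d_iw_i\le W<\sum_{i\le b}d_iw_i$; items $i<b$ are left items and items $i\ge b$ right items. $z$ is an integer (incumbent value); an improved solution is an integer $x$ with $0\le x_i\le d_i$, $\sum_iw_ix_i\le W$ and $\sum_ip_ix_i\ge z+1$. The unfixed availability vector $u\in\mathbb{Z}^n$, $0\le u_i\le d_i$, satisfies: every improved solution has $d_i-u_i\le x_i\le d_i$ for left $i$ and $x_i\le u_i$ for right $i$. The modified instance for $h$: for left $i\notin I^1_{\text{left}}$, $f_i=d_i-u_i$, $r_i=u_i$; for $i\in I^1_{\text{left}}\setminus\{h\}$, $f_i=d_i$, $r_i=0$; $f_h=d_h-1$, $r_h=0$; for right $i$, $f_i=0$, $r_i=u_i$. -}

module Defs where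

open import Data.Nat as ℕ using (ℕ; zero; suc; _+_; _*_; _∸_; _<_; _≤_; _≟_; _<?_)
open import Data.Nat.GCD using (gcd)
open import Data.Nat.DivMod using (_/_)
open import Data.Fin as Fin using (Fin; toℕ)
open import Data.Integer as ℤ using (ℤ; +_)
open import Data.Rational as ℚ using (ℚ)
open import Relation.Nullary using (yes; no)
open import Data.Product using (_×_)
open import Data.Bool using (if_then_else_)

sumF : {n : ℕ} → (Fin n → ℕ) → ℕ
sumF {zero}  a = 0
sumF {suc n} a = a Fin.zero + sumF (λ i → a (Fin.suc i))

-- efficiency p / w as a rational (weights are positive, so the
-- w = 0 branch is never used under the hypotheses)
eff : ℕ → ℕ → ℚ
eff p zero    = ℚ.0ℚ
eff p (suc k) = (+ p) ℚ./ suc k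

-- ⌊ a / c ⌋ * c  (c = 0 branch never used: γ > 0 under the hypotheses)
floorMul : ℕ → ℕ → ℕ
floorMul a zero    = 0
floorMul a (suc k) = (a / suc k) * suc k

ι : ℕ → ℚ
ι m = (+ m) ℚ./ 1

-- gcd of { w i : r i > 0 }  (gcd of the empty family = 0)
gcdOver : {m : ℕ} → (Fin m → ℕ) → (Fin m → ℕ) → ℕ
gcdOver {zero}  w r = 0
gcdOver {suc m} w r with r Fin.zero
... | zero  = gcdOver (λ i → w (Fin.suc i)) (λ i → r (Fin.suc i))
... | suc _ = gcd (w Fin.zero) (gcdOver (λ i → w (Fin.suc i)) (λ i → r (Fin.suc i)))

record BKP (n : ℕ) : Set where
  field
    p w d : Fin n → ℕ
    W     : ℕ

module _ {n : ℕ} (I : BKP n) where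
  open BKP I

  e : Fin n → ℚ
  e i = eff (p i) (w i)

  Left : Fin n → Fin n → Set
  Left b i = toℕ i < toℕ b

  dwBefore dwUpTo : Fin n → ℕ
  dwBefore b = sumF (λ i → if toℕ i ℕ.<ᵇ toℕ b then d i * w i else 0)
  dwUpTo   b = sumF (λ i → if toℕ i ℕ.<ᵇ suc (toℕ b) then d i * w i else 0)

  Improved : ℤ → (Fin n → ℕ) → Set
  Improved z x = ((i : Fin n) → x i ≤ d i)
               × (sumF (λ i → w i * x i) ≤ W)
               × (z ℤ.+ ℤ.1ℤ ℤ.≤ (+ sumF (λ i → p i * x i)))

  fixedAmt : (b : Fin n) (u : Fin n → ℕ) (h : Fin n) → Fin n → ℕ
  fixedAmt b u h i with toℕ i <? toℕ b
  ... | no _ = 0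
  ... | yes _ with u i ≟ 1
  ...   | no _ = d i ∸ u i
  ...   | yes _ with i Fin.≟ h
  ...     | yes _ = d i ∸ 1
  ...     | no _  = d i

  residual : (b : Fin n) (u : Fin n → ℕ) (h : Fin n) → Fin n → ℕ
  residual b u h i with toℕ i <? toℕ b
  ... | no _ = u i
  ... | yes _ with u i ≟ 1
  ...   | no _ = u i
  ...   | yes _ = 0

  gcdRes : (r : Fin n → ℕ) → ℕ
  gcdRes r = gcdOver w r

  pHat wHat : (f : Fin n → ℕ) → ℕ
  pHat f = sumF (λ i → f i * p i)
  wHat f = sumF (λ i → f i * w i)

  Wbar : (f r : Fin n → ℕ) → ℕ
  Wbar f r = wHat f + floorMul (W ∸ wHat f) (gcdRes r)

  UB : (f r : Fin n → ℕ) (g : Fin n) → ℚ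
  UB f r g = ι (pHat f) ℚ.+ ι (Wbar f r ∸ wHat f) ℚ.* e g

-- Write a feasible x as f + y with 0 ≤ y ≤ r. The fixed part contributes
-- exactly (p̂_h, ŵ_h), so the residual weight T = Σ w_i y_i is at most
-- W − ŵ_h; it is a multiple of γ, since y vanishes outside I_res, hence
-- T ≤ W̄_h − ŵ_h. Every residual item has efficiency at most e_g, so the
-- residual profit is at most e_g T ≤ (W̄_h − ŵ_h) e_g.
module Submission where

open import Defs
open import Data.Nat using (ℕ; _≤_; _<_; _+_; _*_; _∸_)
open import Data.Fin using (Fin; toℕ)
open import Data.Integer using (ℤ)
open import Data.Rational as ℚ using (ℚ)
open import Data.Product using (_×_; ∃)
open import Relation.Binary.PropositionalEquality using (_≡_)
open import Relation.Nullary using (¬_)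

open import Data.Nat using (zero; suc; z≤n; s≤s)
import Data.Nat.Properties as ℕ
open import Data.Nat.Divisibility using (_∣_; divides; _∣0; ∣-trans; ∣m∣n⇒∣m+n; ∣m⇒∣m*n)
open import Data.Nat.GCD using (gcd; gcd[m,n]∣m; gcd[m,n]∣n; gcd[m,n]≢0)
open import Data.Nat.DivMod using (_/_; m*n/n≡m; /-monoˡ-≤)
open import Data.Fin using () renaming (zero to 0F; suc to sucF)
open import Data.Vec.Functional using (tail)
open import Data.Integer as ℤ using ()
import Data.Integer.Properties as ℤ
open import Data.Rational.Unnormalised as ℚᵘ using (ℚᵘ; mkℚᵘ; *≡*; *≤*)
import Data.Rational.Unnormalised.Properties as ℚᵘ
import Data.Rational.Properties as ℚ
open import Data.Product using (proj₁; proj₂)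
open import Data.Sum using (inj₁; inj₂)
open import Relation.Binary.PropositionalEquality
  using (refl; sym; trans; cong; cong₂; subst; subst₂; module ≡-Reasoning)
open import Algebra.Properties.CommutativeMonoid.Sum ℕ.+-0-commutativeMonoid
  using (sum; sum-cong-≗; ∑-distrib-+)

sumF≡sum : ∀ {m} (a : Fin m → ℕ) → sumF a ≡ sum a
sumF≡sum {zero}  a = refl
sumF≡sum {suc m} a = cong (a 0F +_) (sumF≡sum (tail a))

sumF-cong : ∀ {m} {a b : Fin m → ℕ} → (∀ i → a i ≡ b i) → sumF a ≡ sumF b
sumF-cong {a = a} {b} a≗b = trans (sumF≡sum a) (trans (sum-cong-≗ a≗b) (sym (sumF≡sum b)))

sumF-+ : ∀ {m} (a b : Fin m → ℕ) → sumF (λ i → a i + b i) ≡ sumF a + sumF b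
sumF-+ a b = trans (sumF≡sum (λ i → a i + b i))
  (trans (∑-distrib-+ a b) (sym (cong₂ _+_ (sumF≡sum a) (sumF≡sum b))))

sumF-*-split : ∀ {m} (c x f y : Fin m → ℕ) → (∀ i → x i ≡ f i + y i) →
  sumF (λ i → c i * x i) ≡ sumF (λ i → f i * c i) + sumF (λ i → c i * y i)
sumF-*-split c x f y x≗f+y = trans (sumF-cong split) (sumF-+ (λ i → f i * c i) (λ i → c i * y i))
  where
  split : ∀ i → c i * x i ≡ f i * c i + c i * y i
  split i = begin
    c i * x i             ≡⟨ cong (c i *_) (x≗f+y i) ⟩
    c i * (f i + y i)     ≡⟨ ℕ.*-distribˡ-+ (c i) (f i) (y i) ⟩
    c i * f i + c i * y i ≡⟨ cong (_+ c i * y i) (ℕ.*-comm (c i) (f i)) ⟩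
    f i * c i + c i * y i ∎
    where open ≡-Reasoning

-- The mediant inequality Σ p_i y_i / Σ w_i y_i ≤ q / c, cross-multiplied.
sumF-ratio-≤ : ∀ {m} (p w y : Fin m → ℕ) (q c : ℕ) →
  (∀ i → 0 < y i → p i * c ≤ q * w i) →
  sumF (λ i → p i * y i) * c ≤ q * sumF (λ i → w i * y i)
sumF-ratio-≤ {zero}  p w y q c ratio = z≤n
sumF-ratio-≤ {suc m} p w y q c ratio = begin
  (p 0F * y 0F + P) * c       ≡⟨ ℕ.*-distribʳ-+ c (p 0F * y 0F) P ⟩
  p 0F * y 0F * c + P * c     ≤⟨ ℕ.+-mono-≤ (first (y 0F) (ratio 0F)) rest ⟩
  q * (w 0F * y 0F) + q * Wt  ≡⟨ ℕ.*-distribˡ-+ q (w 0F * y 0F) Wt ⟨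
  q * (w 0F * y 0F + Wt)      ∎
  where
  open ℕ.≤-Reasoning
  open import Algebra.Properties.CommutativeSemigroup ℕ.*-commutativeSemigroup using (xy∙z≈xz∙y)
  P  = sumF (λ i → p (sucF i) * y (sucF i))
  Wt = sumF (λ i → w (sucF i) * y (sucF i))
  rest : P * c ≤ q * Wt
  rest = sumF-ratio-≤ (tail p) (tail w) (tail y) q c (λ i → ratio (sucF i))
  first : ∀ y₀ → (0 < y₀ → p 0F * c ≤ q * w 0F) → p 0F * y₀ * c ≤ q * (w 0F * y₀)
  first zero _ rewrite ℕ.*-zeroʳ (p 0F) | ℕ.*-zeroʳ (w 0F) | ℕ.*-zeroʳ q = z≤n
  first y₀@(suc _) ratio₀ = begin
    p 0F * y₀ * c     ≡⟨ xy∙z≈xz∙y (p 0F) y₀ c ⟩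
    p 0F * c * y₀     ≤⟨ ℕ.*-monoˡ-≤ y₀ (ratio₀ (s≤s z≤n)) ⟩
    q * w 0F * y₀     ≡⟨ ℕ.*-assoc q (w 0F) y₀ ⟩
    q * (w 0F * y₀)   ∎

gcdOver∣sumF : ∀ {m} (w r y : Fin m → ℕ) → (∀ i → y i ≤ r i) →
  gcdOver w r ∣ sumF (λ i → w i * y i)
gcdOver∣sumF {zero}  w r y y≤r = 0 ∣0
gcdOver∣sumF {suc m} w r y y≤r with r 0F | y≤r 0F
... | zero  | y₀≤0 rewrite ℕ.n≤0⇒n≡0 y₀≤0 | ℕ.*-zeroʳ (w 0F) =
  gcdOver∣sumF (tail w) (tail r) (tail y) (λ i → y≤r (sucF i))
... | suc _ | _ = ∣m∣n⇒∣m+n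
  (∣m⇒∣m*n (y 0F) (gcd[m,n]∣m (w 0F) (gcdOver (tail w) (tail r))))
  (∣-trans (gcd[m,n]∣n (w 0F) (gcdOver (tail w) (tail r)))
           (gcdOver∣sumF (tail w) (tail r) (tail y) (λ i → y≤r (sucF i))))

gcdOver>0 : ∀ {m} (w r : Fin m → ℕ) (i : Fin m) → 0 < r i → 0 < w i → 0 < gcdOver w r
gcdOver>0 w r 0F r₀>0 w₀>0 with r 0F | r₀>0
... | suc _ | _ = ℕ.n≢0⇒n>0 (gcd[m,n]≢0 (w 0F) (gcdOver (tail w) (tail r)) (inj₁ (ℕ.n>0⇒n≢0 w₀>0)))
gcdOver>0 w r (sucF i) rᵢ>0 wᵢ>0 with r 0F
... | zero  = gcdOver>0 (tail w) (tail r) i rᵢ>0 wᵢ>0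
... | suc _ = ℕ.n≢0⇒n>0 (gcd[m,n]≢0 (w 0F) (gcdOver (tail w) (tail r))
                (inj₂ (ℕ.n>0⇒n≢0 (gcdOver>0 (tail w) (tail r) i rᵢ>0 wᵢ>0))))

∣∧≤⇒≤floorMul : ∀ {a c t} → 0 < c → c ∣ t → t ≤ a → t ≤ floorMul a c
∣∧≤⇒≤floorMul {a} {suc k} _ (divides q refl) q*c≤a = ℕ.*-monoˡ-≤ (suc k)
  (subst (_≤ a / suc k) (m*n/n≡m q (suc k)) (/-monoˡ-≤ (suc k) q*c≤a))

ι-+ : ∀ m n → ι (m + n) ≡ ι m ℚ.+ ι n
ι-+ m n = ℚ.toℚᵘ-injective (ℚᵘ.≃-trans (ℚ.toℚᵘ-fromℚᵘ [ m + n ])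
  (ℚᵘ.≃-trans [+]≃+ (ℚᵘ.≃-sym (ℚᵘ.≃-trans (ℚ.toℚᵘ-homo-+ (ι m) (ι n))
    (ℚᵘ.+-cong (ℚ.toℚᵘ-fromℚᵘ [ m ]) (ℚ.toℚᵘ-fromℚᵘ [ n ]))))))
  where
  [_] : ℕ → ℚᵘ
  [ k ] = mkℚᵘ (ℤ.+ k) 0
  [+]≃+ : [ m + n ] ℚᵘ.≃ [ m ] ℚᵘ.+ [ n ]
  [+]≃+ = *≡* (begin
    ℤ.+ (m + n) ℤ.* ℤ.+ 1                              ≡⟨ ℤ.*-identityʳ (ℤ.+ (m + n)) ⟩
    ℤ.+ (m + n)                                        ≡⟨ ℤ.pos-+ m n ⟩
    ℤ.+ m ℤ.+ ℤ.+ n                                    ≡⟨ cong₂ ℤ._+_ (ℤ.*-identityʳ (ℤ.+ m)) (ℤ.*-identityʳ (ℤ.+ n)) ⟨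
    ℤ.+ m ℤ.* ℤ.+ 1 ℤ.+ ℤ.+ n ℤ.* ℤ.+ 1                ≡⟨ ℤ.*-identityʳ _ ⟨
    (ℤ.+ m ℤ.* ℤ.+ 1 ℤ.+ ℤ.+ n ℤ.* ℤ.+ 1) ℤ.* ℤ.+ 1    ∎)
    where open ≡-Reasoning

ι≤ι*eff : ∀ {s m q c} → 0 < c → s * c ≤ q * m → ι s ℚ.≤ ι m ℚ.* eff q c
ι≤ι*eff {s} {m} {q} {suc k} _ s*c≤q*m = ℚ.toℚᵘ-cancel-≤
  (ℚᵘ.≤-respˡ-≃ (ℚᵘ.≃-sym (ℚ.toℚᵘ-fromℚᵘ (mkℚᵘ (ℤ.+ s) 0)))
  (ℚᵘ.≤-respʳ-≃ (ℚᵘ.≃-sym (ℚᵘ.≃-trans (ℚ.toℚᵘ-homo-* (ι m) (eff q (suc k)))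
                 (ℚᵘ.*-cong (ℚ.toℚᵘ-fromℚᵘ (mkℚᵘ (ℤ.+ m) 0)) (ℚ.toℚᵘ-fromℚᵘ (mkℚᵘ (ℤ.+ q) k)))))
  (*≤* (subst₂ ℤ._≤_ lhs rhs (ℤ.+≤+ s*c≤q*m)))))
  where
  lhs : ℤ.+ (s * suc k) ≡ ℤ.+ s ℤ.* ℤ.+ (1 * suc k)
  lhs = trans (cong (λ d → ℤ.+ (s * d)) (sym (ℕ.*-identityˡ (suc k)))) (ℤ.pos-* s (1 * suc k))
  rhs : ℤ.+ (q * m) ≡ (ℤ.+ m ℤ.* ℤ.+ q) ℤ.* ℤ.+ 1
  rhs = trans (cong ℤ.+_ (ℕ.*-comm q m)) (trans (ℤ.pos-* m q) (sym (ℤ.*-identityʳ _)))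

eff-≤⇒*-≤ : ∀ {p q wp wq} → 0 < wp → 0 < wq → eff p wp ℚ.≤ eff q wq → p * wq ≤ q * wp
eff-≤⇒*-≤ {p} {q} {suc a} {suc b} _ _ ep≤eq
  with ℚᵘ.≤-respʳ-≃ (ℚ.toℚᵘ-fromℚᵘ (mkℚᵘ (ℤ.+ q) b))
         (ℚᵘ.≤-respˡ-≃ (ℚ.toℚᵘ-fromℚᵘ (mkℚᵘ (ℤ.+ p) a)) (ℚ.toℚᵘ-mono-≤ ep≤eq))
... | *≤* p*wq≤q*wp = ℤ.drop‿+≤+
  (subst₂ ℤ._≤_ (sym (ℤ.pos-* p (suc b))) (sym (ℤ.pos-* q (suc a))) p*wq≤q*wp)

UB-upper-bound : ∀ {n} (I : BKP n) (f r : Fin n → ℕ) (g : Fin n) →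
  let open BKP I in
  (∀ i → 0 < w i) → 0 < r g → (∀ i → 0 < r i → e I i ℚ.≤ e I g) →
  (x : Fin n → ℕ) → (∀ i → (f i ≤ x i) × (x i ≤ f i + r i)) →
  sumF (λ i → w i * x i) ≤ W →
  ι (sumF (λ i → p i * x i)) ℚ.≤ UB I f r g
UB-upper-bound I f r g w>0 rg>0 g-best x f≤x≤f+r x-fits = begin
  ι (sumF (λ i → p i * x i))   ≡⟨ cong ι (sumF-*-split p x f y x≗f+y) ⟩
  ι (p̂ + S)                    ≡⟨ ι-+ p̂ S ⟩
  ι p̂ ℚ.+ ι S                  ≤⟨ ℚ.+-monoʳ-≤ (ι p̂) (ι≤ι*eff {S} {M} (w>0 g) S*wg≤pg*M) ⟩
  ι p̂ ℚ.+ ι M ℚ.* e I g        ≡⟨ cong (λ t → ι p̂ ℚ.+ ι t ℚ.* e I g) (ℕ.m+n∸m≡n ŵ M) ⟨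
  UB I f r g                   ∎
  where
  open BKP I
  open ℚ.≤-Reasoning
  p̂ = pHat I f
  ŵ = wHat I f
  M = floorMul (W ∸ ŵ) (gcdRes I r)
  y : Fin _ → ℕ
  y i = x i ∸ f i
  x≗f+y : ∀ i → x i ≡ f i + y i
  x≗f+y i = sym (ℕ.m+[n∸m]≡n (proj₁ (f≤x≤f+r i)))
  y≤r : ∀ i → y i ≤ r i
  y≤r i = ℕ.m≤n+o⇒m∸n≤o (x i) (f i) (proj₂ (f≤x≤f+r i))
  S = sumF (λ i → p i * y i)
  T = sumF (λ i → w i * y i)
  T≤W∸ŵ : T ≤ W ∸ ŵ
  T≤W∸ŵ = subst (_≤ W ∸ ŵ) (ℕ.m+n∸m≡n ŵ T)
    (ℕ.∸-monoˡ-≤ ŵ (subst (_≤ W) (sumF-*-split w x f y x≗f+y) x-fits))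
  T≤M : T ≤ M
  T≤M = ∣∧≤⇒≤floorMul (gcdOver>0 w r g rg>0 (w>0 g)) (gcdOver∣sumF w r y y≤r) T≤W∸ŵ
  S*wg≤pg*M : S * w g ≤ p g * M
  S*wg≤pg*M = ℕ.≤-trans
    (sumF-ratio-≤ p w y (p g) (w g)
      (λ i yᵢ>0 → eff-≤⇒*-≤ (w>0 i) (w>0 g) (g-best i (ℕ.<-≤-trans yᵢ>0 (y≤r i)))))
    (ℕ.*-monoʳ-≤ (p g) T≤M)

corollary1 : (n : ℕ) (I : BKP n) →
    let open BKP I in
    ((i : Fin n) → (0 < p i) × (0 < w i) × (0 < d i)) →
    ((i j : Fin n) → toℕ i ≤ toℕ j → e I j ℚ.≤ e I i) →
    (b : Fin n) → dwBefore I b ≤ W → W < dwUpTo I b →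
    (z : ℤ) (u : Fin n → ℕ) → ((i : Fin n) → u i ≤ d i) →
    ((x : Fin n → ℕ) → Improved I z x → (i : Fin n) →
    (Left I b i → d i ∸ u i ≤ x i) × (¬ Left I b i → x i ≤ u i)) →
    (h : Fin n) → Left I b h → u h ≡ 1 →
    let f = fixedAmt I b u h
        r = residual I b u h
    in
    (∃ λ i → 0 < r i) →
    (g : Fin n) → 0 < r g → ((i : Fin n) → 0 < r i → e I i ℚ.≤ e I g) →
    (x : Fin n → ℕ) → ((i : Fin n) → (f i ≤ x i) × (x i ≤ f i + r i)) →
    sumF (λ i → w i * x i) ≤ W →
    ι (sumF (λ i → p i * x i)) ℚ.≤ UB I f r g
corollary1 n I positive _ b _ _ _ u _ _ h _ _ _ g rg>0 g-best =
  UB-upper-bound I (fixedAmt I b u h) (residual I b u h) g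
    (λ i → proj₁ (proj₂ (positive i))) rg>0 g-best
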